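{- Suppose $\langle X\mid R\rangle$ is a presentation of a group $G$ with reversible relations, and let $x_{i_1},x_{i_2},\ldots,x_{i_\ell}\in X\cup X^{ -1}$. Then the factorizations $(x_{i_1},x_{i_2},\ldots,x_{i_\ell})$ and $(x_{i_\ell},x_{i_{\ell-1}},\ldots,x_{i_1})$ of elements of $G$ have Hurwitz orbits of the same size.
   Context: $X=\{x_1,\ldots,x_n\}$, $F(X)$ is the free group on $X$ (reduced words on $X\cup X^{ -1}$), and $\langle X\mid R\rangle$ with $R\subset F(X)$ presents $G\cong F(X)/N$, $N$ the normal closure of $R$ in $F(X)$. For $a=x_{j_1}\cdots x_{j_p}\in F(X)$ with letters in $X\cup X^{ -1}$, the reverse is $a^*=x_{j_p}\cdots x_{j_1}$. The presentation has reversible relations if $r^*\in N$ for every $r\in R$. For $1\le i\le\ell-1$, the Hurwitz move $\sigma_i$ sends $(y_1,\ldots,y_i,y_{i+1},\ldots,y_\ell)$ to $(y_1,\ldots,y_{i+1},y_{i+1}^{ -1}y_iy_{i+1},\ldots,y_\ell)$, with inverse $\sigma_i^{ -1}$ sending it to $(y_1,\ldots,y_iy_{i+1}y_i^{ -1},y_i,\ldots,y_\ell)$. The Hurwitz orbit of a factorization (tuple of group elements) is the set of factorizations obtainable from it by finite sequences of Hurwitz moves and their inverses; its size is its cardinality. -}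

module Defs where

open import Level using (0ℓ; suc)
open import Data.Nat using (ℕ)
open import Data.Fin using (Fin)
open import Data.Bool using (Bool; true; false; not)
open import Data.Product using (_×_; _,_; Σ; ∃; proj₁)
open import Data.List using (List; []; _∷_; _++_; reverse; map; [_])
open import Data.Vec using (Vec; []; _∷_)
open import Data.Vec.Relation.Binary.Pointwise.Inductive using (Pointwise)
open import Relation.Binary.Construct.Closure.ReflexiveTransitive using (Star)
open import Relation.Binary.Bundles using (Setoid)
open import Relation.Binary.Structures using (IsEquivalence)
import Data.Vec.Relation.Binary.Pointwise.Inductive as PW

-- A letter of X ∪ X⁻¹ with X = {x_0,…,x_{n-1}}: (i , true) is x_i, (i , false) is x_i⁻¹.
Letter : ℕ → Set
Letter n = Fin n × Bool

-- Words over X ∪ X⁻¹ (elements of F(X) up to free reduction).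
Word : ℕ → Set
Word n = List (Letter n)

letterInv : ∀ {n} → Letter n → Letter n
letterInv (i , b) = (i , not b)

winv : ∀ {n} → Word n → Word n
winv w = reverse (map letterInv w)

rev : ∀ {n} → Word n → Word n
rev w = reverse w

Relators : ℕ → Set₁
Relators n = Word n → Set

-- Equality in G = F(X)/N, N the normal closure of R:
-- the congruence on words generated by free cancellation and r = 1 for r ∈ R.
data _≈⟨_⟩_ {n : ℕ} : Word n → Relators n → Word n → Set₁ where
  ≈refl   : ∀ {R w} → w ≈⟨ R ⟩ w
  ≈sym    : ∀ {R u v} → u ≈⟨ R ⟩ v → v ≈⟨ R ⟩ u
  ≈trans  : ∀ {R u v w} → u ≈⟨ R ⟩ v → v ≈⟨ R ⟩ w → u ≈⟨ R ⟩ w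
  ≈cong   : ∀ {R u u' v v'} → u ≈⟨ R ⟩ u' → v ≈⟨ R ⟩ v' → (u ++ v) ≈⟨ R ⟩ (u' ++ v')
  ≈cancel : ∀ {R} (a : Letter n) → (a ∷ letterInv a ∷ []) ≈⟨ R ⟩ []
  ≈rel    : ∀ {R r} → R r → r ≈⟨ R ⟩ []

Reversible : ∀ {n} → Relators n → Set₁
Reversible {n} R = ∀ (r : Word n) → R r → rev r ≈⟨ R ⟩ []

data HMove {n : ℕ} : ∀ {ℓ} → Vec (Word n) ℓ → Vec (Word n) ℓ → Set where
  σ     : ∀ {ℓ} (a b : Word n) (t : Vec (Word n) ℓ) →
          HMove (a ∷ b ∷ t) (b ∷ (winv b ++ a ++ b) ∷ t)
  σ⁻¹   : ∀ {ℓ} (a b : Word n) (t : Vec (Word n) ℓ) →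
          HMove (a ∷ b ∷ t) ((a ++ b ++ winv a) ∷ a ∷ t)
  there : ∀ {ℓ} (x : Word n) {t t' : Vec (Word n) ℓ} →
          HMove t t' → HMove (x ∷ t) (x ∷ t')

_≋⟨_⟩_ : ∀ {n ℓ} → Vec (Word n) ℓ → Relators n → Vec (Word n) ℓ → Set₁
s ≋⟨ R ⟩ t = Pointwise (λ u v → u ≈⟨ R ⟩ v) s t

InOrbit : ∀ {n ℓ} → Relators n → Vec (Word n) ℓ → Vec (Word n) ℓ → Set₁
InOrbit R s t = ∃ λ t' → Star HMove s t' × (t' ≋⟨ R ⟩ t)

OrbitSetoid : ∀ {n ℓ} → Relators n → Vec (Word n) ℓ → Setoid (suc 0ℓ) (suc 0ℓ)
OrbitSetoid {n} {ℓ} R s = record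
  { Carrier = Σ (Vec (Word n) ℓ) (InOrbit R s)
  ; _≈_ = λ x y → proj₁ x ≋⟨ R ⟩ proj₁ y
  ; isEquivalence = record
      { refl  = PW.refl ≈refl
      ; sym   = PW.sym ≈sym
      ; trans = PW.trans ≈trans
      }
  }

letters : ∀ {n ℓ} → Vec (Letter n) ℓ → Vec (Word n) ℓ
letters = Data.Vec.map [_]

{-# OPTIONS --safe #-}
-- Word reversal w ↦ w* respects free cancellation, and respects the relators
-- exactly when they are reversible, so it induces an anti-automorphism of G.
-- Mirroring a factorization (reversing every entry and the order of the
-- entries) therefore turns σᵢ into σ_{ℓ-i}⁻¹ and σᵢ⁻¹ into σ_{ℓ-i}. Being an
-- involution, it maps the Hurwitz orbit of (x_{i_1},…,x_{i_ℓ}) bijectively onto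
-- the orbit of its mirror image, which is (x_{i_ℓ},…,x_{i_1}) because
-- one-letter words are their own reverses.
module Submission where

open import Defs
open import Data.Nat using (ℕ)
open import Data.Vec using (Vec; reverse)
open import Function.Bundles using (Bijection)

open import Level using (Level)
open import Data.Bool.Properties using (not-involutive)
open import Data.Product using (_,_)
open import Data.List as List using (_++_; [_]; map)
open import Data.List.Properties using (reverse-++; reverse-involutive; reverse-map; ++-assoc)
open import Data.Vec using ([]; _∷_; _∷ʳ_)
open import Data.Vec.Properties using (map-∷ʳ; reverse-∷)
open import Data.Vec.Relation.Binary.Pointwise.Inductive using (Pointwise; []; _∷_)
open import Function.Bundles using (Inverse)
open import Function.Properties.Inverse using (Inverse⇒Bijection)
open import Relation.Binary.Core using (Rel)
open import Relation.Binary.Construct.Closure.ReflexiveTransitive using (gmap)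
open import Relation.Binary.PropositionalEquality using (_≡_; refl; subst; cong; cong₂; sym; trans; module ≡-Reasoning)

module _ {a r : Level} {A : Set a} {_∼_ : Rel A r} where

  Pointwise-∷ʳ⁺ : ∀ {k} {xs ys : Vec A k} {x y} →
                  Pointwise _∼_ xs ys → x ∼ y → Pointwise _∼_ (xs ∷ʳ x) (ys ∷ʳ y)
  Pointwise-∷ʳ⁺ []          x∼y = x∼y ∷ []
  Pointwise-∷ʳ⁺ (p ∷ xs∼ys) x∼y = p ∷ Pointwise-∷ʳ⁺ xs∼ys x∼y

module _ {n : ℕ} where

  letterInv-involutive : (a : Letter n) → letterInv (letterInv a) ≡ a
  letterInv-involutive (i , b) = cong (i ,_) (not-involutive b)

  rev-winv : (w : Word n) → rev (winv w) ≡ winv (rev w)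
  rev-winv w = begin
    rev (winv w)                ≡⟨ reverse-involutive (map letterInv w) ⟩
    map letterInv w             ≡⟨ sym (reverse-involutive (map letterInv w)) ⟩
    rev (rev (map letterInv w)) ≡⟨ cong rev (sym (reverse-map letterInv w)) ⟩
    winv (rev w)                ∎
    where open ≡-Reasoning

  rev-++-++ : (u v w : Word n) → rev (u ++ v ++ w) ≡ rev w ++ rev v ++ rev u
  rev-++-++ u v w = begin
    rev (u ++ v ++ w)           ≡⟨ reverse-++ u (v ++ w) ⟩
    rev (v ++ w) ++ rev u       ≡⟨ cong (_++ rev u) (reverse-++ v w) ⟩
    (rev w ++ rev v) ++ rev u   ≡⟨ ++-assoc (rev w) (rev v) (rev u) ⟩
    rev w ++ rev v ++ rev u     ∎
    where open ≡-Reasoning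

  mirror : ∀ {ℓ} → Vec (Word n) ℓ → Vec (Word n) ℓ
  mirror []       = []
  mirror (w ∷ ws) = mirror ws ∷ʳ rev w

  mirror-∷ʳ : ∀ {ℓ} (ws : Vec (Word n) ℓ) w → mirror (ws ∷ʳ w) ≡ rev w ∷ mirror ws
  mirror-∷ʳ []       w = refl
  mirror-∷ʳ (v ∷ ws) w = cong (_∷ʳ rev v) (mirror-∷ʳ ws w)

  mirror-involutive : ∀ {ℓ} (ws : Vec (Word n) ℓ) → mirror (mirror ws) ≡ ws
  mirror-involutive []       = refl
  mirror-involutive (w ∷ ws) = trans (mirror-∷ʳ (mirror ws) (rev w))
    (cong₂ _∷_ (reverse-involutive w) (mirror-involutive ws))

  mirror-letters : ∀ {ℓ} (xs : Vec (Letter n) ℓ) → mirror (letters xs) ≡ letters (reverse xs)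
  mirror-letters []       = refl
  mirror-letters (x ∷ xs) = begin
    mirror (letters xs) ∷ʳ [ x ]    ≡⟨ cong (_∷ʳ [ x ]) (mirror-letters xs) ⟩
    letters (reverse xs) ∷ʳ [ x ]   ≡⟨ sym (map-∷ʳ [_] x (reverse xs)) ⟩
    letters (reverse xs ∷ʳ x)       ≡⟨ cong letters (sym (reverse-∷ x xs)) ⟩
    letters (reverse (x ∷ xs))      ∎
    where open ≡-Reasoning

  HMove-∷ʳ : ∀ {ℓ} {s t : Vec (Word n) ℓ} w → HMove s t → HMove (s ∷ʳ w) (t ∷ʳ w)
  HMove-∷ʳ w (σ a b t)   = σ a b (t ∷ʳ w)
  HMove-∷ʳ w (σ⁻¹ a b t) = σ⁻¹ a b (t ∷ʳ w)
  HMove-∷ʳ w (there v m) = there v (HMove-∷ʳ w m)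

  HMove-lastPair : ∀ {ℓ} (ws : Vec (Word n) ℓ) {a b a' b'} →
                   HMove (a ∷ b ∷ []) (a' ∷ b' ∷ []) →
                   HMove (ws ∷ʳ a ∷ʳ b) (ws ∷ʳ a' ∷ʳ b')
  HMove-lastPair []       m = m
  HMove-lastPair (w ∷ ws) m = there w (HMove-lastPair ws m)

  mirror-σ : (a b : Word n) → HMove (rev b ∷ rev a ∷ []) (rev (winv b ++ a ++ b) ∷ rev b ∷ [])
  mirror-σ a b rewrite rev-++-++ (winv b) a b | rev-winv b = σ⁻¹ (rev b) (rev a) []

  mirror-σ⁻¹ : (a b : Word n) → HMove (rev b ∷ rev a ∷ []) (rev a ∷ rev (a ++ b ++ winv a) ∷ [])
  mirror-σ⁻¹ a b rewrite rev-++-++ a b (winv a) | rev-winv a = σ (rev b) (rev a) []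

  mirror-HMove : ∀ {ℓ} {s t : Vec (Word n) ℓ} → HMove s t → HMove (mirror s) (mirror t)
  mirror-HMove (σ a b t)   = HMove-lastPair (mirror t) (mirror-σ a b)
  mirror-HMove (σ⁻¹ a b t) = HMove-lastPair (mirror t) (mirror-σ⁻¹ a b)
  mirror-HMove (there w m) = HMove-∷ʳ (rev w) (mirror-HMove m)

module _ {n : ℕ} {R : Relators n} (reversible : Reversible R) where

  rev-cong : ∀ {u v} → u ≈⟨ R ⟩ v → rev u ≈⟨ R ⟩ rev v
  rev-cong ≈refl        = ≈refl
  rev-cong (≈sym p)     = ≈sym (rev-cong p)
  rev-cong (≈trans p q) = ≈trans (rev-cong p) (rev-cong q)
  rev-cong (≈cong {u = u} {u'} {v} {v'} p q)
    rewrite reverse-++ u v | reverse-++ u' v' = ≈cong (rev-cong q) (rev-cong p)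
  rev-cong (≈cancel a) =
    subst (λ b → ([ letterInv a ] ++ [ b ]) ≈⟨ R ⟩ List.[]) (letterInv-involutive a) (≈cancel (letterInv a))
  rev-cong (≈rel {r = r} r∈R) = reversible r r∈R

  mirror-cong : ∀ {ℓ} {s t : Vec (Word n) ℓ} → s ≋⟨ R ⟩ t → mirror s ≋⟨ R ⟩ mirror t
  mirror-cong []        = []
  mirror-cong (p ∷ s≋t) = Pointwise-∷ʳ⁺ (mirror-cong s≋t) (rev-cong p)

  mirror-InOrbit : ∀ {ℓ} {s t : Vec (Word n) ℓ} → InOrbit R s t → InOrbit R (mirror s) (mirror t)
  mirror-InOrbit (t' , moves , t'≋t) = mirror t' , gmap mirror mirror-HMove moves , mirror-cong t'≋t

  ≋-mirror⇒mirror-≋ : ∀ {ℓ} {s t : Vec (Word n) ℓ} → s ≋⟨ R ⟩ mirror t → mirror s ≋⟨ R ⟩ t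
  ≋-mirror⇒mirror-≋ {t = t} s≋t* =
    subst (_ ≋⟨ R ⟩_) (mirror-involutive t) (mirror-cong s≋t*)

  mirror-orbitInverse : ∀ {ℓ} (s : Vec (Word n) ℓ) →
                        Inverse (OrbitSetoid R s) (OrbitSetoid R (mirror s))
  mirror-orbitInverse s = record
    { to        = λ (t , t∈s) → mirror t , mirror-InOrbit t∈s
    ; from      = λ (t , t∈s*) → mirror t ,
                    subst (λ u → InOrbit R u (mirror t)) (mirror-involutive s) (mirror-InOrbit t∈s*)
    ; to-cong   = mirror-cong
    ; from-cong = mirror-cong
    ; inverse   = ≋-mirror⇒mirror-≋ , ≋-mirror⇒mirror-≋
    }

corollary6p7 : (n : ℕ) (R : Relators n) → Reversible R →
    (ℓ : ℕ) (xs : Vec (Letter n) ℓ) →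
    Bijection (OrbitSetoid R (letters xs)) (OrbitSetoid R (letters (reverse xs)))
corollary6p7 n R reversible ℓ xs =
  subst (λ s → Bijection (OrbitSetoid R (letters xs)) (OrbitSetoid R s))
        (mirror-letters xs)
        (Inverse⇒Bijection (mirror-orbitInverse reversible (letters xs)))
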